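{- Each of the following intervals $[\mathcal{C}_1,\mathcal{C}_2]=\{\mathcal{K}\in{\bf E}_{\mathbb{B}}:\mathcal{C}_1\subseteq\mathcal{K}\subseteq\mathcal{C}_2\}$ contains uncountably many equational classes: (i) $[\mathcal{C},\Omega]$ for $\mathcal{C}\in\{T_0,T_1,L,S,M\}$; (ii) $[\mathcal{C},T_0]$ for $\mathcal{C}\in\{T_c,L_0,M_0,U_2\}$; (iii) $[\mathcal{C},T_1]$ for $\mathcal{C}\in\{T_c,L_1,M_1,W_2\}$; (iv) $[\mathcal{C},T_c]$ for $\mathcal{C}\in\{M_c,S_c,T_c\cap U_2,T_c\cap W_2\}$.
   Context: $\Omega$ is the set of all Boolean functions $\{0,1\}^n\to\{0,1\}$, $n\ge1$. An equational class is a set of Boolean functions closed under $f\mapsto f(p_1,\dots,p_n)$ for projections $p_i$; ${\bf E}_{\mathbb{B}}$ is the set of them. $T_0=\{f:f(0,\dots,0)=0\}$, $T_1=\{f:f(1,\dots,1)=1\}$, $T_c=T_0\cap T_1$. $M$ = monotone functions (componentwise order), $M_0=M\cap T_0$, $M_1=M\cap T_1$, $M_c=M\cap T_c$. The dual of $n$-ary $f$ is $f^d({\bf a})=1-f(\bar{\bf a})$ where $\bar{\bf a}$ is the componentwise complement; $S=\{f:f^d=f\}$ (self-dual functions), $S_c=S\cap T_c$. $L$ = functions $c_0\oplus c_1x_1\oplus\cdots\oplus c_nx_n$ ($c_i\in\{0,1\}$, $\oplus$ addition mod 2), $L_0=L\cap T_0$, $L_1=L\cap T_1$. A set $B\subseteq\{0,1\}^n$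 is $a$-separating ($a\in\{0,1\}$) if some coordinate $i$ has $b_i=a$ for all $b\in B$; $U_2$ (resp. $W_2$) is the class of functions $f$ such that every subset of $f^{ -1}(1)$ (resp. $f^{ -1}(0)$) of size at most $2$ is $1$-separating (resp. $0$-separating). -}

module Defs where

open import Level using (0ℓ)
open import Data.Nat using (ℕ; zero; suc) renaming (_≤_ to _≤ℕ_)
open import Data.Fin using (Fin; zero; suc)
open import Data.Bool using (Bool; true; false; not; _∧_; _xor_; _≤_)
open import Data.List using (List; length)
open import Data.List.Relation.Unary.All using (All)
open import Data.Product using (Σ; ∃; _×_; _,_)
open import Data.Unit using (⊤)
open import Function using (_∘_)
open import Relation.Unary using (Pred; _⊆_; _∩_)
open import Relation.Binary.PropositionalEquality using (_≡_)

-- A Boolean function of arity n ≥ 1, encoded as arity (suc m).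
BF : Set
BF = Σ ℕ λ m → (Fin (suc m) → Bool) → Bool

Class : Set₁
Class = Pred BF 0ℓ

-- f ↦ f(p_1,…,p_n), where p_i is the k-ary projection onto coordinate σ i.
minor : ∀ {m k} → ((Fin (suc m) → Bool) → Bool) → (Fin (suc m) → Fin (suc k))
      → (Fin (suc k) → Bool) → Bool
minor f σ a = f (a ∘ σ)

-- Classes are sets of functions: membership respects extensional equality.
RespectsExt : Class → Set
RespectsExt K = ∀ {m} (f g : (Fin (suc m) → Bool) → Bool)
              → (∀ a → f a ≡ g a) → K (m , f) → K (m , g)

EquationalClass : Class → Set
EquationalClass K =
  RespectsExt K ×
  (∀ {m k} (f : (Fin (suc m) → Bool) → Bool) (σ : Fin (suc m) → Fin (suc k))
     → K (m , f) → K (k , minor f σ))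

Ω : Class
Ω _ = ⊤

T₀ T₁ Tc M M₀ M₁ Mc S Sc L L₀ L₁ U₂ W₂ : Class
T₀ (m , f) = f (λ _ → false) ≡ false
T₁ (m , f) = f (λ _ → true) ≡ true
Tc = T₀ ∩ T₁
M (m , f) = ∀ a b → (∀ i → a i ≤ b i) → f a ≤ f b
M₀ = M ∩ T₀
M₁ = M ∩ T₁
Mc = M ∩ Tc
S (m , f) = ∀ a → not (f (not ∘ a)) ≡ f a
Sc = S ∩ Tc

xorSum : ∀ {n} → (Fin n → Bool) → Bool
xorSum {zero} v = false
xorSum {suc n} v = v zero xor xorSum (v ∘ suc)

L (m , f) = Σ Bool λ c₀ → Σ (Fin (suc m) → Bool) λ c →
            ∀ a → f a ≡ c₀ xor xorSum (λ i → c i ∧ a i)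
L₀ = L ∩ T₀
L₁ = L ∩ T₁

Separating : ∀ {n} → Bool → List (Fin n → Bool) → Set
Separating {n} v B = ∃ λ (i : Fin n) → All (λ b → b i ≡ v) B

U₂ (m , f) = ∀ (B : List (Fin (suc m) → Bool)) → length B ≤ℕ 2
           → All (λ b → f b ≡ true) B → Separating true B
W₂ (m , f) = ∀ (B : List (Fin (suc m) → Bool)) → length B ≤ℕ 2
           → All (λ b → f b ≡ false) B → Separating false B

InInterval : Class → Class → Class → Set
InInterval C₁ C₂ K = EquationalClass K × C₁ ⊆ K × K ⊆ C₂

SameClass : Class → Class → Set
SameClass K K' = ∀ x → (K x → K' x) × (K' x → K x)

-- uncountably many: an injection from Cantor space 2^ℕ into the collection
UncountablyMany : (Class → Set) → Set₁
UncountablyMany P = Σ ((ℕ → Bool) → Class) λ F →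
  (∀ s → P (F s)) × (∀ s t → SameClass (F s) (F t) → ∀ i → s i ≡ t i)

data Case : Set where
  iT₀ iT₁ iL iS iM : Case
  iiTc iiL₀ iiM₀ iiU₂ : Case
  iiiTc iiiL₁ iiiM₁ iiiW₂ : Case
  ivMc ivSc ivTcU₂ ivTcW₂ : Case

lower upper : Case → Class
lower iT₀ = T₀
lower iT₁ = T₁
lower iL = L
lower iS = S
lower iM = M
lower iiTc = Tc
lower iiL₀ = L₀
lower iiM₀ = M₀
lower iiU₂ = U₂
lower iiiTc = Tc
lower iiiL₁ = L₁
lower iiiM₁ = M₁
lower iiiW₂ = W₂
lower ivMc = Mc
lower ivSc = Sc
lower ivTcU₂ = Tc ∩ U₂
lower ivTcW₂ = Tc ∩ W₂
upper iT₀ = Ω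
upper iT₁ = Ω
upper iL = Ω
upper iS = Ω
upper iM = Ω
upper iiTc = T₀
upper iiL₀ = T₀
upper iiM₀ = T₀
upper iiU₂ = T₀
upper iiiTc = T₁
upper iiiL₁ = T₁
upper iiiM₁ = T₁
upper iiiW₂ = T₁
upper ivMc = Tc
upper ivSc = Tc
upper ivTcU₂ = Tc
upper ivTcW₂ = Tc

-- The functions "exactly one argument is 1", its negation, and "exactly one argument is 1,
-- or all are", taken in every arity n ≥ 4, form antichains for the minor order: a minor of such a
-- function that is again one of them must rename the variables bijectively. Hence for any
-- minor-closed class C₂ containing such an antichain F, the classes of members of C₂
-- that have no F i with s i = 0 as a minor are equational, and distinct sequences s
-- give distinct classes. Such a class contains C₁ whenever the F i fail some
-- minor-closed property that holds throughout C₁: monotonicity, self-duality,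
-- f(a ⊕ b ⊕ c) = f a ⊕ f b ⊕ f c, or a 1- resp. 0-separation property for pairs.
module Submission where

open import Defs
open import Data.Nat using (ℕ; zero; suc; _+_; z≤n; s≤s) renaming (_≤_ to _≤ℕ_)
open import Data.Nat.Properties using (≤-antisym; +-cancelˡ-≡; suc-injective)
open import Data.Fin using (Fin; zero; suc; punchIn)
open import Data.Fin.Properties using (injective⇒≤; punchInᵢ≢i)
open import Data.Bool using (Bool; true; false; not; _∧_; _∨_; _xor_; if_then_else_; b≤b; f≤t)
  renaming (_≤_ to _≤ᵇ_)
open import Data.Bool.Properties using (¬-not; not-¬; ⇔→≡; ∨-zeroʳ; not-injective)
open import Data.Bool.Properties using (not-distribˡ-xor; xor-annihilates-not; ∧-distribˡ-xor; xor-∧-commutativeRing)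
open import Data.List using ([]; _∷_; length)
open import Data.List.Relation.Unary.All using (All; []; _∷_)
open import Data.Product using (∃; ∃!; _×_; _,_; proj₁; proj₂)
open import Data.Sum using (_⊎_; inj₁; inj₂)
open import Data.Unit using (tt)
open import Function using (_∘_; id)
open import Function.Bundles using (_⇔_; mk⇔)
import Function.Properties.Equivalence as ⇔
open import Relation.Nullary using (¬_; contradiction)
open import Relation.Unary using (_⊆_)
open import Relation.Binary.PropositionalEquality
  using (_≡_; refl; sym; trans; cong; cong₂; subst; subst₂; module ≡-Reasoning)
open import Algebra.Bundles using (CommutativeRing)
open import Algebra.Properties.CommutativeSemigroup
  (CommutativeRing.+-commutativeSemigroup xor-∧-commutativeRing) using (interchange)

-- The minor order

infix 4 _≼_

record _≼_ (g f : BF) : Set where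
  constructor _,_
  field
    rename : Fin (suc (proj₁ f)) → Fin (suc (proj₁ g))
    agrees : ∀ a → proj₂ g a ≡ proj₂ f (a ∘ rename)

≼-refl : ∀ {f} → f ≼ f
≼-refl = id , λ _ → refl

≼-trans : ∀ {f g h} → h ≼ g → g ≼ f → h ≼ f
≼-trans (τ , h≗g) (σ , g≗f) = τ ∘ σ , λ a → trans (h≗g a) (g≗f (a ∘ τ))

MinorClosed : Class → Set
MinorClosed K = ∀ {f g} → g ≼ f → K f → K g

MinorClosed⇒EquationalClass : ∀ {K} → MinorClosed K → EquationalClass K
MinorClosed⇒EquationalClass closed =
  (λ f g f≗g → closed (id , λ a → sym (f≗g a))) ,
  (λ f σ → closed (σ , λ _ → refl))

≼-outside : ∀ {P f g} → MinorClosed P → ¬ P g → P f → ¬ g ≼ f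
≼-outside closed ¬Pg Pf g≼f = ¬Pg (closed g≼f Pf)

-- Uncountably many classes from an antichain

Antichain : (ℕ → BF) → Set
Antichain F = ∀ {i j} → F i ≼ F j → i ≡ j

Avoiding : Class → (ℕ → BF) → (ℕ → Bool) → Class
Avoiding C F s f = C f × (∀ j → s j ≡ false → ¬ F j ≼ f)

module _ {C : Class} {F : ℕ → BF} where

  Avoiding-closed : MinorClosed C → ∀ s → MinorClosed (Avoiding C F s)
  Avoiding-closed closed s g≼f (Cf , avoids) =
    closed g≼f Cf , λ j sj≡false Fj≼g → avoids j sj≡false (≼-trans Fj≼g g≼f)

  Avoiding-member : Antichain F → (∀ j → C (F j)) → ∀ s i → Avoiding C F s (F i) ⇔ s i ≡ true
  Avoiding-member antichain F⊆C s i = mk⇔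
    (λ (_ , avoids) → ¬-not λ si≡false → avoids i si≡false ≼-refl)
    (λ si≡true → F⊆C i , λ j sj≡false Fj≼Fi →
      contradiction (trans (sym si≡true) (trans (cong s (sym (antichain Fj≼Fi))) sj≡false)) λ ())

uncountablyMany-between : ∀ {C₁ C₂ P F} → Antichain F
  → MinorClosed C₂ → (∀ j → C₂ (F j)) → C₁ ⊆ C₂
  → MinorClosed P → (∀ j → ¬ P (F j)) → C₁ ⊆ P
  → UncountablyMany (InInterval C₁ C₂)
uncountablyMany-between {C₁} {C₂} {P} {F} antichain C₂-closed F⊆C₂ C₁⊆C₂ P-closed F⊈P C₁⊆P =
  Avoiding C₂ F , inInterval , injective
  where
  inInterval : ∀ s → InInterval C₁ C₂ (Avoiding C₂ F s)
  inInterval s = MinorClosed⇒EquationalClass (Avoiding-closed C₂-closed s) ,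
                 (λ C₁f → C₁⊆C₂ C₁f , λ j _ → ≼-outside P-closed (F⊈P j) (C₁⊆P C₁f)) ,
                 proj₁

  injective : ∀ s t → SameClass (Avoiding C₂ F s) (Avoiding C₂ F t) → ∀ i → s i ≡ t i
  injective s t same i =
    ⇔→≡ (⇔.trans (⇔.sym (member s i)) (⇔.trans (mk⇔ (proj₁ (same (F i))) (proj₂ (same (F i)))) (member t i)))
    where member = Avoiding-member {C₂} antichain F⊆C₂

-- Exactly one, or all

allTrue : ∀ {n} → (Fin n → Bool) → Bool
allTrue {zero}  w = true
allTrue {suc n} w = w zero ∧ allTrue (w ∘ suc)

exactlyOne : ∀ {n} → (Fin n → Bool) → Bool
exactlyOne {zero}  w = false
exactlyOne {suc n} w = if w zero then allTrue (not ∘ w ∘ suc) else exactlyOne (w ∘ suc)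

allTrue-const : ∀ n → allTrue {n} (λ _ → true) ≡ true
allTrue-const zero    = refl
allTrue-const (suc n) = allTrue-const n

allTrue⇒ : ∀ {n} (w : Fin n → Bool) → allTrue w ≡ true → ∀ i → w i ≡ true
allTrue⇒ {suc n} w all i with w zero in w₀≡true
allTrue⇒ {suc n} w all zero    | true = w₀≡true
allTrue⇒ {suc n} w all (suc i) | true = allTrue⇒ (w ∘ suc) all i

exactlyOne-const : ∀ n → exactlyOne {n} (λ _ → false) ≡ false
exactlyOne-const zero    = refl
exactlyOne-const (suc n) = exactlyOne-const n

exactlyOne⇒∃! : ∀ {n} (w : Fin n → Bool) → exactlyOne w ≡ true → ∃! _≡_ λ i → w i ≡ true
exactlyOne⇒∃! {suc n} w one with w zero in w₀
... | true = zero , w₀ , only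
  where
  only : ∀ {j} → w j ≡ true → zero ≡ j
  only {zero}  _        = refl
  only {suc j} wj≡true =
    contradiction (trans (cong not (sym wj≡true)) (allTrue⇒ (not ∘ w ∘ suc) one j)) λ ()
... | false with exactlyOne⇒∃! (w ∘ suc) one
...   | i , wi≡true , unique = suc i , wi≡true , only
  where
  only : ∀ {j} → w j ≡ true → suc i ≡ j
  only {zero}  w₀≡true = contradiction (trans (sym w₀) w₀≡true) λ ()
  only {suc j} wj≡true = cong suc (unique wj≡true)

basis : ∀ {n} → Fin n → Fin n → Bool
basis zero    zero    = true
basis zero    (suc _) = false
basis (suc i) zero    = false
basis (suc i) (suc j) = basis i j

basis-diag : ∀ {n} (i : Fin n) → basis i i ≡ true
basis-diag zero    = refl
basis-diag (suc i) = basis-diag i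

basis⇒≡ : ∀ {n} {i j : Fin n} → basis i j ≡ true → i ≡ j
basis⇒≡ {i = zero}  {zero}  _  = refl
basis⇒≡ {i = suc i} {suc j} eq = cong suc (basis⇒≡ eq)

exactlyOne-basis : ∀ {n} (i : Fin n) → exactlyOne (basis i) ≡ true
exactlyOne-basis {suc n} zero    = allTrue-const n
exactlyOne-basis {suc n} (suc i) = exactlyOne-basis i

oneOrAll : Bool → ∀ {n} → (Fin n → Bool) → Bool
oneOrAll withAll w = (withAll ∧ allTrue w) ∨ exactlyOne w

oneOrAll-basis : ∀ withAll {n} (i : Fin n) → oneOrAll withAll (basis i) ≡ true
oneOrAll-basis withAll i rewrite exactlyOne-basis i = ∨-zeroʳ (withAll ∧ allTrue (basis i))

oneOrAll⇒ : ∀ withAll {n} (w : Fin n → Bool) → oneOrAll withAll w ≡ true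
  → (∀ i → w i ≡ true) ⊎ (exactlyOne w ≡ true)
oneOrAll⇒ true  w eq with allTrue w in all
... | true  = inj₁ (allTrue⇒ w all)
... | false = inj₂ eq
oneOrAll⇒ false w eq = inj₂ eq

oneOrAll-≼⇒arity≡ : ∀ withAll {k m} → (suc k , oneOrAll withAll) ≼ (m , oneOrAll withAll) → suc k ≡ m
oneOrAll-≼⇒arity≡ withAll {k} {m} (σ , g≗f) =
  suc-injective (≤-antisym (injective⇒≤ section-injective) (injective⇒≤ σ-injective))
  where
  pulled-basis : ∀ i → oneOrAll withAll (basis i ∘ σ) ≡ true
  pulled-basis i = trans (sym (g≗f (basis i))) (oneOrAll-basis withAll i)

  hits : ∀ i → ∃ λ x → σ x ≡ i
  hits i with oneOrAll⇒ withAll (basis i ∘ σ) (pulled-basis i)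
  ... | inj₁ all = zero , sym (basis⇒≡ (all zero))
  ... | inj₂ one with exactlyOne⇒∃! (basis i ∘ σ) one
  ...   | x , bx , _ = x , sym (basis⇒≡ bx)

  -- Two variables merged by σ would make basis (σ x) ∘ σ have two ones, hence all ones,
  -- so σ would be constant, which it is not since it hits everything.
  σ-injective : ∀ {x y} → σ x ≡ σ y → x ≡ y
  σ-injective {x} {y} σx≡σy with oneOrAll⇒ withAll (basis (σ x) ∘ σ) (pulled-basis (σ x))
  ... | inj₁ all with hits (punchIn (σ x) zero)
  ...   | z , σz≡j = contradiction (trans (sym σz≡j) (sym (basis⇒≡ (all z)))) (punchInᵢ≢i (σ x) zero)
  σ-injective {x} {y} σx≡σy | inj₂ one with exactlyOne⇒∃! (basis (σ x) ∘ σ) one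
  ...   | _ , _ , unique =
    trans (sym (unique (basis-diag (σ x)))) (unique (subst (λ j → basis (σ x) j ≡ true) σx≡σy (basis-diag (σ x))))

  section-injective : ∀ {i j} → proj₁ (hits i) ≡ proj₁ (hits j) → i ≡ j
  section-injective {i} {j} eq = trans (sym (proj₂ (hits i))) (trans (cong σ eq) (proj₂ (hits j)))

family : Bool → ℕ → BF
family withAll j = 3 + j , oneOrAll withAll

family-antichain : ∀ withAll → Antichain (family withAll)
family-antichain withAll Fi≼Fj = +-cancelˡ-≡ 3 _ _ (oneOrAll-≼⇒arity≡ withAll Fi≼Fj)

negate : BF → BF
negate (m , f) = m , not ∘ f

negate-reflects-≼ : ∀ {f g} → negate g ≼ negate f → g ≼ f
negate-reflects-≼ {m , f} {k , g} (σ , ¬g≗¬f) = σ , λ a → not-injective (¬g≗¬f a)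

negate-antichain : ∀ {F} → Antichain F → Antichain (negate ∘ F)
negate-antichain antichain = antichain ∘ negate-reflects-≼

-- Minor-closed properties

Affine : Class
Affine (m , f) = ∀ a b c → f (λ i → a i xor (b i xor c i)) ≡ f a xor (f b xor f c)

PairSeparating : Bool → Class
PairSeparating v (m , f) = ∀ a b → f a ≡ v → f b ≡ v → ∃ λ i → a i ≡ v × b i ≡ v

Ω-closed : MinorClosed Ω
Ω-closed _ _ = tt

T₀-closed : MinorClosed T₀
T₀-closed {m , f} {k , g} (σ , g≗f) f₀ = trans (g≗f _) f₀

T₁-closed : MinorClosed T₁
T₁-closed {m , f} {k , g} (σ , g≗f) f₁ = trans (g≗f _) f₁

Tc-closed : MinorClosed Tc
Tc-closed g≼f (f₀ , f₁) = T₀-closed g≼f f₀ , T₁-closed g≼f f₁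

M-closed : MinorClosed M
M-closed {m , f} {k , g} (σ , g≗f) monotone a b a≤b =
  subst₂ _≤ᵇ_ (sym (g≗f a)) (sym (g≗f b)) (monotone (a ∘ σ) (b ∘ σ) (a≤b ∘ σ))

S-closed : MinorClosed S
S-closed {m , f} {k , g} (σ , g≗f) selfDual a = begin
  not (g (not ∘ a))     ≡⟨ cong not (g≗f (not ∘ a)) ⟩
  not (f (not ∘ a ∘ σ)) ≡⟨ selfDual (a ∘ σ) ⟩
  f (a ∘ σ)             ≡⟨ sym (g≗f a) ⟩
  g a                   ∎
  where open ≡-Reasoning

Affine-closed : MinorClosed Affine
Affine-closed {m , f} {k , g} (σ , g≗f) affine a b c = begin
  g (λ i → a i xor (b i xor c i))         ≡⟨ g≗f _ ⟩
  f (λ i → a (σ i) xor (b (σ i) xor c (σ i))) ≡⟨ affine (a ∘ σ) (b ∘ σ) (c ∘ σ) ⟩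
  f (a ∘ σ) xor (f (b ∘ σ) xor f (c ∘ σ)) ≡⟨ sym (cong₂ _xor_ (g≗f a) (cong₂ _xor_ (g≗f b) (g≗f c))) ⟩
  g a xor (g b xor g c)                   ∎
  where open ≡-Reasoning

PairSeparating-closed : ∀ v → MinorClosed (PairSeparating v)
PairSeparating-closed v {m , f} {k , g} (σ , g≗f) separating a b ga≡v gb≡v
  with separating (a ∘ σ) (b ∘ σ) (trans (sym (g≗f a)) ga≡v) (trans (sym (g≗f b)) gb≡v)
... | i , ai≡v , bi≡v = σ i , ai≡v , bi≡v

xorSum-cong : ∀ {n} {u v : Fin n → Bool} → (∀ i → u i ≡ v i) → xorSum u ≡ xorSum v
xorSum-cong {zero}  u≗v = refl
xorSum-cong {suc n} u≗v = cong₂ _xor_ (u≗v zero) (xorSum-cong (u≗v ∘ suc))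

xorSum-xor : ∀ {n} (u v : Fin n → Bool) → xorSum (λ i → u i xor v i) ≡ xorSum u xor xorSum v
xorSum-xor {zero}  u v = refl
xorSum-xor {suc n} u v =
  trans (cong ((u zero xor v zero) xor_) (xorSum-xor (u ∘ suc) (v ∘ suc))) (interchange (u zero) (v zero) (xorSum (u ∘ suc)) (xorSum (v ∘ suc)))

xor-affine : ∀ c x y z → c xor (x xor (y xor z)) ≡ (c xor x) xor ((c xor y) xor (c xor z))
xor-affine false x y z = refl
xor-affine true  x y z = trans (not-distribˡ-xor x (y xor z)) (cong (not x xor_) (sym (xor-annihilates-not y z)))

L⊆Affine : L ⊆ Affine
L⊆Affine {m , f} (c₀ , c , f≗) a b d = begin
  f (λ i → a i xor (b i xor d i))      ≡⟨ f≗ _ ⟩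
  c₀ xor lin (λ i → a i xor (b i xor d i))
    ≡⟨ cong (c₀ xor_) (trans (lin-xor a (λ i → b i xor d i)) (cong (lin a xor_) (lin-xor b d))) ⟩
  c₀ xor (lin a xor (lin b xor lin d)) ≡⟨ xor-affine c₀ _ _ _ ⟩
  (c₀ xor lin a) xor ((c₀ xor lin b) xor (c₀ xor lin d))
    ≡⟨ sym (cong₂ _xor_ (f≗ a) (cong₂ _xor_ (f≗ b) (f≗ d))) ⟩
  f a xor (f b xor f d)                ∎
  where
  open ≡-Reasoning
  lin : (Fin (suc m) → Bool) → Bool
  lin w = xorSum (λ i → c i ∧ w i)
  lin-xor : ∀ u v → lin (λ i → u i xor v i) ≡ lin u xor lin v
  lin-xor u v = trans (xorSum-cong λ i → ∧-distribˡ-xor (c i) (u i) (v i)) (xorSum-xor (λ i → c i ∧ u i) (λ i → c i ∧ v i))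

pairs-separating : ∀ {v m} {f : (Fin (suc m) → Bool) → Bool}
  → (∀ B → length B ≤ℕ 2 → All (λ b → f b ≡ v) B → Separating v B) → PairSeparating v (m , f)
pairs-separating separating a b fa≡v fb≡v
  with separating (a ∷ b ∷ []) (s≤s (s≤s z≤n)) (fa≡v ∷ fb≡v ∷ [])
... | i , ai≡v ∷ bi≡v ∷ [] = i , ai≡v , bi≡v

PairSeparating⇒const : ∀ {v m} {f : (Fin (suc m) → Bool) → Bool}
  → PairSeparating v (m , f) → f (λ _ → not v) ≡ not v
PairSeparating⇒const separating = ¬-not λ f≡v →
  not-¬ refl (sym (proj₁ (proj₂ (separating _ _ f≡v f≡v))))

U₂⊆PairSeparating : U₂ ⊆ PairSeparating true
U₂⊆PairSeparating {m , f} = pairs-separating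

W₂⊆PairSeparating : W₂ ⊆ PairSeparating false
W₂⊆PairSeparating {m , f} = pairs-separating

U₂⊆T₀ : U₂ ⊆ T₀
U₂⊆T₀ {m , f} = PairSeparating⇒const {true} ∘ U₂⊆PairSeparating {m , f}

W₂⊆T₁ : W₂ ⊆ T₁
W₂⊆T₁ {m , f} = PairSeparating⇒const {false} ∘ W₂⊆PairSeparating {m , f}

exactlyOne∈T₀ : ∀ j → T₀ (family false j)
exactlyOne∈T₀ j = exactlyOne-const (4 + j)

exactlyOne∉T₁ : ∀ j → ¬ T₁ (family false j)
exactlyOne∉T₁ j ()

notExactlyOne∈T₁ : ∀ j → T₁ (negate (family false j))
notExactlyOne∈T₁ j = refl

notExactlyOne∉T₀ : ∀ j → ¬ T₀ (negate (family false j))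
notExactlyOne∉T₀ j notExactlyOne₀≡false = contradiction
  (trans (sym (cong not (exactlyOne-const (4 + j)))) notExactlyOne₀≡false) λ ()

oneOrAll∈Tc : ∀ j → Tc (family true j)
oneOrAll∈Tc j = exactlyOne-const (4 + j) , cong (_∨ exactlyOne {4 + j} (λ _ → true)) (allTrue-const (4 + j))

firstTwo : ∀ {n} → Fin n → Bool
firstTwo zero          = true
firstTwo (suc zero)    = true
firstTwo (suc (suc _)) = false

basis₀≤firstTwo : ∀ {n} (i : Fin (suc n)) → basis zero i ≤ᵇ firstTwo i
basis₀≤firstTwo zero          = b≤b
basis₀≤firstTwo (suc zero)    = f≤t
basis₀≤firstTwo (suc (suc _)) = b≤b

oneOrAll∉M : ∀ j → ¬ M (family true j)
oneOrAll∉M j monotone with subst (_≤ᵇ false) (oneOrAll-basis true {4 + j} zero)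
                             (monotone (basis zero) firstTwo basis₀≤firstTwo)
... | ()

oneOrAll∉S : ∀ j → ¬ S (family true j)
oneOrAll∉S j selfDual with selfDual firstTwo
... | ()

oneOrAll∉Affine : ∀ j → ¬ Affine (family true j)
oneOrAll∉Affine j affine = contradiction (trans (affine e₀ e₁ e₂) ones) λ ()
  where
  e₀ e₁ e₂ : Fin (4 + j) → Bool
  e₀ = basis zero
  e₁ = basis (suc zero)
  e₂ = basis (suc (suc zero))
  ones : oneOrAll true e₀ xor (oneOrAll true e₁ xor oneOrAll true e₂) ≡ true
  ones = cong₂ _xor_ (oneOrAll-basis true {4 + j} zero)
           (cong₂ _xor_ (oneOrAll-basis true {4 + j} (suc zero)) (oneOrAll-basis true {4 + j} (suc (suc zero))))

oneOrAll∉PairSeparating-true : ∀ j → ¬ PairSeparating true (family true j)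
oneOrAll∉PairSeparating-true j separating
  with separating (basis zero) (basis (suc zero)) (oneOrAll-basis true {4 + j} zero) (oneOrAll-basis true {4 + j} (suc zero))
... | i , e₀i≡true , e₁i≡true with trans (basis⇒≡ {i = zero} {i} e₀i≡true) (sym (basis⇒≡ {i = suc zero} {i} e₁i≡true))
...   | ()

oneOrAll∉PairSeparating-false : ∀ j → ¬ PairSeparating false (family true j)
oneOrAll∉PairSeparating-false j separating with separating firstTwo (not ∘ firstTwo) refl refl
... | i , p , q = contradiction (trans (sym (cong not p)) q) λ ()

uncountablyMany-Tc⊆ : ∀ {C₁ C₂ P} → MinorClosed C₂ → Tc ⊆ C₂ → C₁ ⊆ C₂
  → MinorClosed P → (∀ j → ¬ P (family true j)) → C₁ ⊆ P
  → UncountablyMany (InInterval C₁ C₂)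
uncountablyMany-Tc⊆ C₂-closed Tc⊆C₂ =
  uncountablyMany-between (family-antichain true) C₂-closed (λ j → Tc⊆C₂ (oneOrAll∈Tc j))

notExactlyOne-antichain : Antichain (negate ∘ family false)
notExactlyOne-antichain = negate-antichain (family-antichain false)

proposition5 : ∀ (c : Case) → UncountablyMany (InInterval (lower c) (upper c))
proposition5 iT₀ = uncountablyMany-between
  notExactlyOne-antichain Ω-closed (λ _ → tt) (λ _ → tt) T₀-closed notExactlyOne∉T₀ id
proposition5 iT₁ = uncountablyMany-between
  (family-antichain false) Ω-closed (λ _ → tt) (λ _ → tt) T₁-closed exactlyOne∉T₁ id
proposition5 iL = uncountablyMany-Tc⊆
  Ω-closed (λ _ → tt) (λ _ → tt) Affine-closed oneOrAll∉Affine L⊆Affine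
proposition5 iS = uncountablyMany-Tc⊆
  Ω-closed (λ _ → tt) (λ _ → tt) S-closed oneOrAll∉S id
proposition5 iM = uncountablyMany-Tc⊆
  Ω-closed (λ _ → tt) (λ _ → tt) M-closed oneOrAll∉M id
proposition5 iiTc = uncountablyMany-between
  (family-antichain false) T₀-closed exactlyOne∈T₀ proj₁ T₁-closed exactlyOne∉T₁ proj₂
proposition5 iiL₀ = uncountablyMany-Tc⊆
  T₀-closed proj₁ proj₂ Affine-closed oneOrAll∉Affine (L⊆Affine ∘ proj₁)
proposition5 iiM₀ = uncountablyMany-Tc⊆
  T₀-closed proj₁ proj₂ M-closed oneOrAll∉M proj₁
proposition5 iiU₂ = uncountablyMany-Tc⊆
  T₀-closed proj₁ U₂⊆T₀ (PairSeparating-closed true) oneOrAll∉PairSeparating-true U₂⊆PairSeparating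
proposition5 iiiTc = uncountablyMany-between
  notExactlyOne-antichain T₁-closed notExactlyOne∈T₁ proj₂ T₀-closed notExactlyOne∉T₀ proj₁
proposition5 iiiL₁ = uncountablyMany-Tc⊆
  T₁-closed proj₂ proj₂ Affine-closed oneOrAll∉Affine (L⊆Affine ∘ proj₁)
proposition5 iiiM₁ = uncountablyMany-Tc⊆
  T₁-closed proj₂ proj₂ M-closed oneOrAll∉M proj₁
proposition5 iiiW₂ = uncountablyMany-Tc⊆
  T₁-closed proj₂ W₂⊆T₁ (PairSeparating-closed false) oneOrAll∉PairSeparating-false W₂⊆PairSeparating
proposition5 ivMc = uncountablyMany-Tc⊆
  Tc-closed id proj₂ M-closed oneOrAll∉M proj₁
proposition5 ivSc = uncountablyMany-Tc⊆
  Tc-closed id proj₂ S-closed oneOrAll∉S proj₁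
proposition5 ivTcU₂ = uncountablyMany-Tc⊆
  Tc-closed id proj₁ (PairSeparating-closed true) oneOrAll∉PairSeparating-true (U₂⊆PairSeparating ∘ proj₂)
proposition5 ivTcW₂ = uncountablyMany-Tc⊆
  Tc-closed id proj₁ (PairSeparating-closed false) oneOrAll∉PairSeparating-false (W₂⊆PairSeparating ∘ proj₂)
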